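{- Let $\vec U$ be a submodular universe and $k\in\mathbb N$. Let $\vec s\in\vec S_k$ be a splice for $\vec r\in\vec S_k$, and let $\sigma\subseteq\vec S_k$ be a star containing some $\vec x$ with $\vec x\ge\vec r$. Let $\sigma':=\sigma^{\vec s}_{\vec x}$. If a profile $P$ contains both $\sigma$ and $\sigma'$ and $\sigma$ has property $\mathrm{Eff}(P)$, then $\sigma'$ also has property $\mathrm{Eff}(P)$.
   Context: A separation system is a finite poset with an order-reversing involution ${}^*$; write $\overleftarrow s:=\vec s^{\,*}$, $s:=\{\vec s,\overleftarrow s\}$. A universe $\vec U$ is a separation system whose poset is a lattice with join $\vee$, meet $\wedge$. A submodular universe carries an order function $|\cdot|:\vec U\to\mathbb N_0$ with $|\vec s|=|\overleftarrow s|=:|s|$ and $|\vec s|+|\vec t|\ge|\vec s\vee\vec t|+|\vec s\wedge\vec t|$. $\vec S_k:=\{\vec s\in\vec U:|\vec s|<k\}$. A star is a set $\sigma$ of separations with $\vec a\le\overleftarrow b$ for all distinct $\vec a,\vec b\in\sigma$. For a star $\sigma$, $\vec x\in\sigma$ and a separation $\vec s_0$, the shift is $\sigma^{\vec s_0}_{\vec x}:=\{\vec x\vee\vec s_0\}\cup\{\vec y\wedge\overleftarrow{s_0}:\vec y\in\sigma\setminus\{\vec x\}\}$. $\vec s$ is a splice for $\vec r$ if $\vec r\le\vec s$ and there is no $\vec t\in\vec U$ with $\vec r\le\vec t\le\vec s$ and $|t|<|s|$. A profile (of a separation system $\vec S\subseteq \vec U$, e.g. of some $S_\ell$) is a consistent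 orientation $P$ of $S$ (containing exactly one orientation of each separation, and no $\vec a,\vec b$ with $a\ne b$, $\overleftarrow a\le\vec b$) such that $\overleftarrow a\wedge\overleftarrow b\notin P$ for all $\vec a,\vec b\in P$. A star $\sigma$ has property $\mathrm{Eff}(P)$ if there are no $\vec a\in\sigma$ and $\vec a'\in P$ with $\vec a\le\vec a'$ and $|a'|<|a|$. -}

module Defs where

open import Data.Nat using (ℕ; _+_; _≤_; _<_)
open import Data.Fin using (Fin)
open import Data.Product using (Σ; _×_)
open import Data.Sum using (_⊎_)
open import Data.Empty using (⊥)
open import Relation.Nullary using (¬_)
open import Relation.Binary.PropositionalEquality using (_≡_; _≢_)
open import Relation.Binary.Structures using (IsPartialOrder)
open import Relation.Binary.Lattice.Structures using (IsLattice)
open import Function.Bundles using (_↔_)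

record Universe : Set₁ where
  infix 4 _≤ₛ_
  infixr 6 _∨_
  infixr 7 _∧_
  infix 8 _*
  field
    U          : Set
    _≤ₛ_       : U → U → Set
    isPartialOrder : IsPartialOrder _≡_ _≤ₛ_
    _*         : U → U
    involutive : ∀ a → (a *) * ≡ a
    reversing  : ∀ {a b} → a ≤ₛ b → b * ≤ₛ a *
    _∨_        : U → U → U
    _∧_        : U → U → U
    isLattice  : IsLattice _≡_ _≤ₛ_ _∨_ _∧_
    finite     : Σ ℕ (λ n → Fin n ↔ U)

record SubmodularUniverse : Set₁ where
  field
    universe : Universe
  open Universe universe public
  field
    ∣_∣        : U → ℕ
    ∣*∣        : ∀ a → ∣ a * ∣ ≡ ∣ a ∣
    submodular : ∀ a b → ∣ a ∨ b ∣ + ∣ a ∧ b ∣ ≤ ∣ a ∣ + ∣ b ∣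

module Theory (𝒰 : SubmodularUniverse) where
  open SubmodularUniverse 𝒰

  S< : ℕ → U → Set
  S< k a = ∣ a ∣ < k

  IsStar : (U → Set) → Set
  IsStar σ = ∀ a b → σ a → σ b → a ≢ b → a ≤ₛ b *

  shift : (U → Set) → (s₀ x : U) → U → Set
  shift σ s₀ x z = (z ≡ x ∨ s₀) ⊎ Σ U (λ y → σ y × y ≢ x × z ≡ y ∧ s₀ *)

  IsSplice : (s r : U) → Set
  IsSplice s r = r ≤ₛ s × (∀ t → r ≤ₛ t → t ≤ₛ s → ¬ (∣ t ∣ < ∣ s ∣))

  record IsProfileOf (S P : U → Set) : Set where
    field
      P⊆S        : ∀ a → P a → S a
      orients    : ∀ a → S a → P a ⊎ P (a *)
      atMostOne  : ∀ a → P a → P (a *) → a ≡ a *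
      consistent : ∀ a b → P a → P b → a * ≤ₛ b → (a ≡ b ⊎ a ≡ b *)
      profile    : ∀ a b → P a → P b → ¬ P (a * ∧ b *)

  Eff : (P σ : U → Set) → Set
  Eff P σ = ¬ Σ U (λ a → Σ U (λ a' → σ a × P a' × a ≤ₛ a' × ∣ a' ∣ < ∣ a ∣))

module Submission where

open import Defs
open import Data.Nat using (ℕ; _<_; _≤_; _+_)
open import Data.Nat.Properties
open import Data.Product using (Σ; _×_; _,_)
open import Data.Sum using (inj₁; inj₂)
open import Data.Empty using (⊥-elim)
open import Relation.Nullary using (¬_)
open import Relation.Binary.PropositionalEquality using (_≡_; refl; sym; cong; subst)
open import Relation.Binary.Structures using (IsPartialOrder)
open import Relation.Binary.Lattice.Structures using (IsLattice)

-- Shifting x to x ∨ s, and every other y ∈ σ to y ∧ s*, never raises the order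
-- because s is a splice for r and r ≤ x ≤ y*.  So an a' ∈ P above a shifted
-- separation and of smaller order yields, via submodularity, a separation of P
-- above x (resp. above y) of smaller order, contradicting Eff(P) for σ.  In the
-- second case that separation is a' ∨ y, which lies in P because otherwise its
-- inverse a'* ∧ y* would, against the profile property.

m+n≤o+p⇒p≤n⇒m≤o : ∀ {m n o p} → m + n ≤ o + p → p ≤ n → m ≤ o
m+n≤o+p⇒p≤n⇒m≤o {m} {n} {o} {p} m+n≤o+p p≤n =
  +-cancelʳ-≤ p m o (≤-trans (+-monoʳ-≤ m p≤n) m+n≤o+p)

m+n≤o+p⇒o<n⇒m<p : ∀ {m n o p} → m + n ≤ o + p → o < n → m < p
m+n≤o+p⇒o<n⇒m<p {m} {n} {o} {p} m+n≤o+p o<n =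
  +-cancelʳ-< o m p (≤-trans (+-monoʳ-< m o<n) (≤-trans m+n≤o+p (≤-reflexive (+-comm o p))))

module _ (𝒰 : SubmodularUniverse) where
  open SubmodularUniverse 𝒰
  open Theory 𝒰
  open IsPartialOrder isPartialOrder using (trans; antisym)
  open IsLattice isLattice using (x≤x∨y; y≤x∨y; ∨-least; x∧y≤x; x∧y≤y; ∧-greatest)

  ≤*-flip : ∀ {a b} → a ≤ₛ b * → b ≤ₛ a *
  ≤*-flip {a} {b} a≤b* = subst (_≤ₛ a *) (involutive b) (reversing a≤b*)

  *-distrib-∨ : ∀ a b → (a ∨ b) * ≡ a * ∧ b *
  *-distrib-∨ a b = antisym
    (∧-greatest (reversing (x≤x∨y a b)) (reversing (y≤x∨y a b)))
    (≤*-flip (∨-least (≤*-flip (x∧y≤x (a *) (b *))) (≤*-flip (x∧y≤y (a *) (b *)))))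

  ∣∨∣<ʳ : ∀ {a b} → ∣ a ∣ < ∣ a ∧ b ∣ → ∣ a ∨ b ∣ < ∣ b ∣
  ∣∨∣<ʳ {a} {b} = m+n≤o+p⇒o<n⇒m<p (submodular a b)

  profile-∨-closed : ∀ {ℓ P a b} → IsProfileOf (S< ℓ) P →
                     P a → P b → ∣ a ∨ b ∣ < ℓ → P (a ∨ b)
  profile-∨-closed {P = P} {a} {b} prof Pa Pb a∨b<ℓ
    with IsProfileOf.orients prof (a ∨ b) a∨b<ℓ
  ... | inj₁ Pa∨b    = Pa∨b
  ... | inj₂ P[a∨b]* =
    ⊥-elim (IsProfileOf.profile prof a b Pa Pb (subst P (*-distrib-∨ a b) P[a∨b]*))

  splice-≤ : ∀ {s r t} → IsSplice s r → r ≤ₛ t → t ≤ₛ s → ∣ s ∣ ≤ ∣ t ∣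
  splice-≤ (_ , minimal) r≤t t≤s = ≮⇒≥ (minimal _ r≤t t≤s)

  splice-∣∨∣≤ : ∀ {s r x} → IsSplice s r → r ≤ₛ x → ∣ x ∨ s ∣ ≤ ∣ x ∣
  splice-∣∨∣≤ {s} {x = x} spl@(r≤s , _) r≤x =
    m+n≤o+p⇒p≤n⇒m≤o (submodular x s) (splice-≤ spl (∧-greatest r≤x r≤s) (x∧y≤y x s))

  splice-∣∧*∣≤ : ∀ {s r z} → IsSplice s r → z ≤ₛ r * → ∣ z ∧ s * ∣ ≤ ∣ z ∣
  splice-∣∧*∣≤ {s} {z = z} spl z≤r* = begin
    ∣ z ∧ s * ∣       ≡⟨ cong ∣_∣ z∧s*≡[z*∨s]* ⟩
    ∣ (z * ∨ s) * ∣   ≡⟨ ∣*∣ (z * ∨ s) ⟩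
    ∣ z * ∨ s ∣       ≤⟨ splice-∣∨∣≤ spl (≤*-flip z≤r*) ⟩
    ∣ z * ∣           ≡⟨ ∣*∣ z ⟩
    ∣ z ∣             ∎
    where
    open ≤-Reasoning
    z∧s*≡[z*∨s]* : z ∧ s * ≡ (z * ∨ s) *
    z∧s*≡[z*∨s]* = sym (subst (λ w → (z * ∨ s) * ≡ w ∧ s *) (involutive z) (*-distrib-∨ (z *) s))

  EffAt : (U → Set) → U → Set
  EffAt P a = ¬ Σ U (λ a' → P a' × a ≤ₛ a' × ∣ a' ∣ < ∣ a ∣)

  Eff⇒EffAt : ∀ {P σ a} → Eff P σ → σ a → EffAt P a
  Eff⇒EffAt eff σa (a' , Pa' , a≤a' , a'<a) = eff (_ , a' , σa , Pa' , a≤a' , a'<a)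

  EffAt⇒Eff : ∀ {P σ} → (∀ a → σ a → EffAt P a) → Eff P σ
  EffAt⇒Eff effAt (a , a' , σa , Pa' , a≤a' , a'<a) = effAt a σa (a' , Pa' , a≤a' , a'<a)

  splice-∨-EffAt : ∀ {P s r x} → IsSplice s r → r ≤ₛ x → EffAt P x → EffAt P (x ∨ s)
  splice-∨-EffAt {s = s} {x = x} spl r≤x effx (a' , Pa' , x∨s≤a' , a'<x∨s) =
    effx (a' , Pa' , trans (x≤x∨y x s) x∨s≤a' , <-≤-trans a'<x∨s (splice-∣∨∣≤ spl r≤x))

  splice-∧*-EffAt : ∀ {ℓ P s r y} → IsSplice s r → IsProfileOf (S< ℓ) P →
                    P y → y ≤ₛ r * → EffAt P y → EffAt P (y ∧ s *)
  splice-∧*-EffAt {P = P} {s = s} {y = y} spl prof Py y≤r* effy (a' , Pa' , y∧s*≤a' , a'<y∧s*) =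
    effy (a' ∨ y , Pa'∨y , y≤x∨y a' y , a'∨y<y)
    where
    [a'∧y]∧s*≡y∧s* : (a' ∧ y) ∧ s * ≡ y ∧ s *
    [a'∧y]∧s*≡y∧s* = antisym
      (∧-greatest (trans (x∧y≤x _ _) (x∧y≤y a' y)) (x∧y≤y _ _))
      (∧-greatest (∧-greatest y∧s*≤a' (x∧y≤x y (s *))) (x∧y≤y y (s *)))

    y∧s*≤a'∧y : ∣ y ∧ s * ∣ ≤ ∣ a' ∧ y ∣
    y∧s*≤a'∧y = subst (λ w → ∣ w ∣ ≤ ∣ a' ∧ y ∣) [a'∧y]∧s*≡y∧s*
      (splice-∣∧*∣≤ spl (trans (x∧y≤y a' y) y≤r*))

    a'∨y<y : ∣ a' ∨ y ∣ < ∣ y ∣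
    a'∨y<y = ∣∨∣<ʳ (<-≤-trans a'<y∧s* y∧s*≤a'∧y)

    Pa'∨y : P (a' ∨ y)
    Pa'∨y = profile-∨-closed prof Pa' Py (<-trans a'∨y<y (IsProfileOf.P⊆S prof y Py))

mainTheorem6 :
    (𝒰 : SubmodularUniverse) (k : ℕ) →
    let open SubmodularUniverse 𝒰 in
    let open Theory 𝒰 in
    (r s : U) → S< k r → S< k s → IsSplice s r →
    (σ : U → Set) → (∀ a → σ a → S< k a) → IsStar σ →
    (x : U) → σ x → r ≤ₛ x →
    (ℓ : ℕ) (P : U → Set) → IsProfileOf (S< ℓ) P →
    (∀ a → σ a → P a) → (∀ a → shift σ s x a → P a) →
    Eff P σ → Eff P (shift σ s x)
mainTheorem6 𝒰 k r s _ _ spl σ _ star x σx r≤x ℓ P prof σ⊆P _ eff =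
  EffAt⇒Eff 𝒰 shifted-EffAt
  where
  open SubmodularUniverse 𝒰
  open Theory 𝒰
  shifted-EffAt : ∀ a → shift σ s x a → EffAt 𝒰 P a
  shifted-EffAt _ (inj₁ refl) = splice-∨-EffAt 𝒰 spl r≤x (Eff⇒EffAt 𝒰 eff σx)
  shifted-EffAt _ (inj₂ (y , σy , y≢x , refl)) =
    splice-∧*-EffAt 𝒰 spl prof (σ⊆P y σy) y≤r* (Eff⇒EffAt 𝒰 eff σy)
    where
    y≤r* : y ≤ₛ r *
    y≤r* = IsPartialOrder.trans isPartialOrder (star y x σy σx y≢x) (reversing r≤x)
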